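{- Let $d=(d_1,\dots,d_n)$ be a degree sequence in nonincreasing order (a trailing $0$ term appended if necessary) and let $r<t$ be indices such that $d_r\ge d_t+2$, $t$ is the first index after $r$ with $d_t\le d_r-2$, and $r$ is the last index before $t$ with $d_r\ge d_t+2$. Let $e$ be obtained from $d$ by the unit transformation $e_r=d_r-1$, $e_t=d_t+1$, $e_i=d_i$ otherwise, and suppose $e$ is a degree sequence. Define $j_r=d_r+1$ if $d_r\ge r$ and $j_r=d_r$ if $d_r<r$; and $j_t=d_t+2$ if $d_t\ge t-1$ and $j_t=d_t+1$ if $d_t<t-1$. For an integer $k$, let $c_1(d,r,t,k)$ be the number of elements (counted with multiplicity) of the multiset $\{r,j_t\}$ that are $\le k$, and $c_{ -1}(d,r,t,k)$ the number of elements (counted with multiplicity) of $\{t,j_r\}$ that are $\le k$. Then \[\Delta_k(e)=\begin{cases}\Delta_k(d)+c_1(d,r,t,k)-c_{ -1}(d,r,t,k) & \text{if } k\le\min\{m(d),m(e)\};\\ \Delta_{m(d)}(d)+2 & \text{if } k=m(e)>m(d).\end{cases}\]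
   Context: $m(d)=\max\{i:d_i\ge i-1\}$ and $\Delta_k(d)=k(k-1)+\sum_{i>k}\min\{k,d_i\}-\sum_{i\le k}d_i$. (The indices $j_r$, $j_t$ are the columns of the corrected Ferrers diagram of $d$ — the $n\times n$ matrix with stars on the diagonal and, in row $i$, the first $d_i$ non-diagonal entries equal to $1$ — in which the entry of row $r$ changes from $1$ to $0$ and the entry of row $t$ changes from $0$ to $1$.) -}

module Defs where

open import Data.Nat using (ℕ; zero; suc; _+_; _*_; _∸_; _≤_; _<_; _⊓_; _≤ᵇ_; _<ᵇ_)
open import Data.Bool using (Bool; true; false; if_then_else_)
open import Data.Integer using (ℤ; +_) renaming (_+_ to _+ℤ_; _-_ to _-ℤ_)
open import Data.Product using (Σ; _×_)
open import Relation.Binary.PropositionalEquality using (_≡_)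

-- Convention: a sequence d = (d_1,…,d_n) of length n is a function ℕ → ℕ,
-- of which only the values d 1, …, d n are ever used (1-based indices).

sumTo : ℕ → (ℕ → ℕ) → ℕ
sumTo zero    f = 0
sumTo (suc n) f = sumTo n f + f (suc n)

ind : Bool → ℕ
ind true  = 1
ind false = 0

Nonincreasing : ℕ → (ℕ → ℕ) → Set
Nonincreasing n d = ∀ i j → 1 ≤ i → i ≤ j → j ≤ n → d j ≤ d i

DegreeSequence : ℕ → (ℕ → ℕ) → Set
DegreeSequence n d =
  Σ (ℕ → ℕ → Bool) λ adj →
    (∀ i j → adj i j ≡ adj j i) ×
    (∀ i → adj i i ≡ false) ×
    (∀ i → 1 ≤ i → i ≤ n → sumTo n (λ j → ind (adj i j)) ≡ d i)

-- largest i ∈ {1,…,k} with d_i ≥ i - 1 (0 if none)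
mUpTo : (ℕ → ℕ) → ℕ → ℕ
mUpTo d zero    = 0
mUpTo d (suc i) = if suc i ≤ᵇ suc (d (suc i)) then suc i else mUpTo d i

m : ℕ → (ℕ → ℕ) → ℕ
m n d = mUpTo d n

Δ : ℕ → (ℕ → ℕ) → ℕ → ℤ
Δ n d k =
  (+ (k * (k ∸ 1)) +ℤ + sumTo n (λ i → if k <ᵇ i then k ⊓ d i else 0))
    -ℤ + sumTo n (λ i → if i ≤ᵇ k then d i else 0)

unitTransform : (ℕ → ℕ) → ℕ → ℕ → ℕ → ℕ
unitTransform d r t i =
  if i Data.Nat.≡ᵇ r then d r ∸ 1 else (if i Data.Nat.≡ᵇ t then suc (d t) else d i)

jr : (ℕ → ℕ) → ℕ → ℕ
jr d r = if r ≤ᵇ d r then suc (d r) else d r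

jt : (ℕ → ℕ) → ℕ → ℕ
jt d t = if t ≤ᵇ suc (d t) then d t + 2 else suc (d t)

c₁ : (ℕ → ℕ) → ℕ → ℕ → ℕ → ℕ
c₁ d r t k = ind (r ≤ᵇ k) + ind (jt d t ≤ᵇ k)

c₋₁ : (ℕ → ℕ) → ℕ → ℕ → ℕ → ℕ
c₋₁ d r t k = ind (t ≤ᵇ k) + ind (jr d r ≤ᵇ k)

-- Outside r and t the sequences agree, so Δ_k(e) − Δ_k(d) is the sum of two local effects:
-- lowering d_r changes Δ_k by +1 if r ≤ k and by −1 if r > k ≥ d_r, and raising d_t changes it
-- by −1 if t ≤ k and by +1 if t > k ≥ d_t + 1. For k ≤ min(m(d), m(e)) the two tail conditions
-- are precisely j_r ≤ k and j_t ≤ k.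
-- If m(e) > m(d), then m(e) = t = d_t + 2 and m(d) = t − 1. As e_t = t − 1 and all later values
-- are below t, Δ_t(e) = Δ_{t−1}(e), and the first case at k = t − 1, where c₁ = 2 and c₋₁ = 0,
-- gives the second.
module Submission where

open import Defs
open import Data.Bool using (true; false; T; _∧_; if_then_else_)
open import Data.Unit using (tt)
open import Data.Nat
open import Data.Nat.Properties
open import Algebra.Properties.CommutativeSemigroup +-commutativeSemigroup
  using (interchange; xy∙z≈xz∙y)
open import Data.Empty using (⊥-elim)
import Data.Nat.Tactic.RingSolver as ℕ-Solver
open import Data.Integer using (ℤ; +_) renaming (_+_ to _+ℤ_; _-_ to _-ℤ_)
import Data.Integer.Properties as ℤ
import Data.Integer.Tactic.RingSolver as ℤ-Solver
open import Data.List using ([]; _∷_)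
open import Data.Product using (_×_; _,_)
open import Function using (_∘_)
open import Relation.Nullary using (¬_; yes; no; contradiction)
open import Relation.Binary.PropositionalEquality

T⇒≡true : ∀ {b} → T b → b ≡ true
T⇒≡true {true} _ = refl

¬T⇒≡false : ∀ {b} → ¬ T b → b ≡ false
¬T⇒≡false {true}  ¬t = contradiction tt ¬t
¬T⇒≡false {false} _  = refl

≤⇒≤ᵇ≡true : ∀ {m n} → m ≤ n → (m ≤ᵇ n) ≡ true
≤⇒≤ᵇ≡true = T⇒≡true ∘ ≤⇒≤ᵇ

>⇒≤ᵇ≡false : ∀ {m n} → n < m → (m ≤ᵇ n) ≡ false
>⇒≤ᵇ≡false {m} {n} n<m = ¬T⇒≡false (<⇒≱ n<m ∘ ≤ᵇ⇒≤ m n)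

<⇒<ᵇ≡true : ∀ {m n} → m < n → (m <ᵇ n) ≡ true
<⇒<ᵇ≡true = T⇒≡true ∘ <⇒<ᵇ

≥⇒<ᵇ≡false : ∀ {m n} → n ≤ m → (m <ᵇ n) ≡ false
≥⇒<ᵇ≡false {m} {n} n≤m = ¬T⇒≡false (≤⇒≯ n≤m ∘ <ᵇ⇒< m n)

≡ᵇ-refl : ∀ m → (m ≡ᵇ m) ≡ true
≡ᵇ-refl m = T⇒≡true (≡⇒≡ᵇ m m refl)

≢⇒≡ᵇ≡false : ∀ {m n} → m ≢ n → (m ≡ᵇ n) ≡ false
≢⇒≡ᵇ≡false {m} {n} m≢n = ¬T⇒≡false (m≢n ∘ ≡ᵇ⇒≡ m n)

⊓-suc : ∀ k x → k ⊓ suc x ≡ k ⊓ x + ind (suc x ≤ᵇ k)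
⊓-suc k x with suc x ≤? k
... | yes x<k rewrite ≤⇒≤ᵇ≡true x<k | m≥n⇒m⊓n≡n x<k | m≥n⇒m⊓n≡n (<⇒≤ x<k) = +-comm 1 x
... | no  x≮k rewrite >⇒≤ᵇ≡false (≰⇒> x≮k)
                    | m≤n⇒m⊓n≡m (<⇒≤ (≰⇒> x≮k)) | m≤n⇒m⊓n≡m (≤-pred (≰⇒> x≮k)) =
  sym (+-identityʳ k)

tailTerm : ℕ → ℕ → ℕ → ℕ
tailTerm k i x = if k <ᵇ i then k ⊓ x else 0

headTerm : ℕ → ℕ → ℕ → ℕ
headTerm k i x = if i ≤ᵇ k then x else 0

tailTerm-headTerm-suc : ∀ k i {x y} → y ≡ suc x →
  tailTerm k i y + headTerm k i x + ind (i ≤ᵇ k)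
    ≡ tailTerm k i x + headTerm k i y + ind ((k <ᵇ i) ∧ (y ≤ᵇ k))
tailTerm-headTerm-suc k i {x} refl with i ≤? k
... | yes i≤k rewrite ≤⇒≤ᵇ≡true i≤k | ≥⇒<ᵇ≡false i≤k =
  trans (+-comm x 1) (sym (+-identityʳ (suc x)))
... | no  i≰k rewrite >⇒≤ᵇ≡false (≰⇒> i≰k) | <⇒<ᵇ≡true (≰⇒> i≰k) = begin
  k ⊓ suc x + 0 + 0                  ≡⟨ +-identityʳ _ ⟩
  k ⊓ suc x + 0                      ≡⟨ +-identityʳ _ ⟩
  k ⊓ suc x                          ≡⟨ ⊓-suc k x ⟩
  k ⊓ x + ind (suc x ≤ᵇ k)           ≡⟨ cong (_+ ind (suc x ≤ᵇ k)) (sym (+-identityʳ _)) ⟩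
  k ⊓ x + 0 + ind (suc x ≤ᵇ k)       ∎
  where open ≡-Reasoning

sumTo-cong : ∀ n {f g : ℕ → ℕ} → (∀ i → 1 ≤ i → i ≤ n → f i ≡ g i) → sumTo n f ≡ sumTo n g
sumTo-cong zero    _   = refl
sumTo-cong (suc n) f≗g =
  cong₂ _+_ (sumTo-cong n (λ i 1≤i i≤n → f≗g i 1≤i (m≤n⇒m≤1+n i≤n))) (f≗g (suc n) (s≤s z≤n) ≤-refl)

sumTo-+ : ∀ n (f g : ℕ → ℕ) → sumTo n (λ i → f i + g i) ≡ sumTo n f + sumTo n g
sumTo-+ zero    f g = refl
sumTo-+ (suc n) f g =
  trans (cong (_+ (f (suc n) + g (suc n))) (sumTo-+ n f g))
        (interchange (sumTo n f) (sumTo n g) (f (suc n)) (g (suc n)))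

sumTo-one-point : ∀ n {f g : ℕ → ℕ} {r} → 1 ≤ r → r ≤ n →
  (∀ i → 1 ≤ i → i ≤ n → i ≢ r → f i ≡ g i) →
  sumTo n f + g r ≡ sumTo n g + f r
sumTo-one-point zero    (s≤s _) ()
sumTo-one-point (suc n) {f} {g} {r} 1≤r r≤1+n f≗g with r ≟ suc n
... | yes refl =
  trans (cong (λ s → s + f r + g r) (sumTo-cong n f≗g-below))
        (xy∙z≈xz∙y (sumTo n g) (f r) (g r))
  where
  f≗g-below : ∀ i → 1 ≤ i → i ≤ n → f i ≡ g i
  f≗g-below i 1≤i i≤n = f≗g i 1≤i (m≤n⇒m≤1+n i≤n) (<⇒≢ (s≤s i≤n))
... | no  r≢1+n = begin
  sumTo n f + f (suc n) + g r  ≡⟨ xy∙z≈xz∙y (sumTo n f) (f (suc n)) (g r) ⟩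
  sumTo n f + g r + f (suc n)  ≡⟨ cong₂ _+_ IH (f≗g (suc n) (s≤s z≤n) ≤-refl (r≢1+n ∘ sym)) ⟩
  sumTo n g + f r + g (suc n)  ≡⟨ xy∙z≈xz∙y (sumTo n g) (f r) (g (suc n)) ⟩
  sumTo n g + g (suc n) + f r  ∎
  where
  open ≡-Reasoning
  IH : sumTo n f + g r ≡ sumTo n g + f r
  IH = sumTo-one-point n 1≤r (≤-pred (≤∧≢⇒< r≤1+n r≢1+n))
         (λ i 1≤i i≤n → f≗g i 1≤i (m≤n⇒m≤1+n i≤n))

sumTo-two-point : ∀ n {f g : ℕ → ℕ} {r t} → 1 ≤ r → r < t → t ≤ n →
  (∀ i → 1 ≤ i → i ≤ n → i ≢ r → i ≢ t → f i ≡ g i) →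
  sumTo n f + g r + g t ≡ sumTo n g + f r + f t
sumTo-two-point n {f} {g} {r} {t} 1≤r r<t t≤n f≗g = begin
  sumTo n f + g r + g t  ≡⟨ cong (λ x → sumTo n f + x + g t) (sym h-r) ⟩
  sumTo n f + h r + g t  ≡⟨ cong (_+ g t) (sumTo-one-point n 1≤r (<⇒≤ (<-≤-trans r<t t≤n)) f≗h) ⟩
  sumTo n h + f r + g t  ≡⟨ xy∙z≈xz∙y (sumTo n h) (f r) (g t) ⟩
  sumTo n h + g t + f r  ≡⟨ cong (_+ f r) (sumTo-one-point n (≤-trans 1≤r (<⇒≤ r<t)) t≤n h≗g) ⟩
  sumTo n g + h t + f r  ≡⟨ cong (λ x → sumTo n g + x + f r) h-t ⟩
  sumTo n g + f t + f r  ≡⟨ xy∙z≈xz∙y (sumTo n g) (f t) (f r) ⟩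
  sumTo n g + f r + f t  ∎
  where
  open ≡-Reasoning
  h : ℕ → ℕ
  h i = if i ≡ᵇ t then f t else g i
  h-t : h t ≡ f t
  h-t rewrite ≡ᵇ-refl t = refl
  h-r : h r ≡ g r
  h-r rewrite ≢⇒≡ᵇ≡false (<⇒≢ r<t) = refl
  f≗h : ∀ i → 1 ≤ i → i ≤ n → i ≢ r → f i ≡ h i
  f≗h i 1≤i i≤n i≢r with i ≟ t
  ... | yes refl = sym h-t
  ... | no  i≢t rewrite ≢⇒≡ᵇ≡false i≢t = f≗g i 1≤i i≤n i≢r i≢t
  h≗g : ∀ i → 1 ≤ i → i ≤ n → i ≢ t → h i ≡ g i
  h≗g i _ _ i≢t rewrite ≢⇒≡ᵇ≡false i≢t = refl

+-cancel-two-points : ∀ {F G fr ft gr gt a b c d} →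
  F + gr + gt ≡ G + fr + ft → ft + a ≡ gt + b → gr + c ≡ fr + d →
  F + (a + d) ≡ G + (c + b)
+-cancel-two-points {F} {G} {fr} {ft} {gr} {gt} {a} {b} {c} {d} sums at-t at-r =
  +-cancelʳ-≡ (gr + gt) _ _ (begin
    F + (a + d) + (gr + gt)       ≡⟨ solve (F ∷ gr ∷ gt ∷ a ∷ d ∷ []) ⟩
    F + gr + gt + (a + d)         ≡⟨ cong (_+ (a + d)) sums ⟩
    G + fr + ft + (a + d)         ≡⟨ solve (G ∷ fr ∷ ft ∷ a ∷ d ∷ []) ⟩
    G + (ft + a) + (fr + d)       ≡⟨ cong₂ (λ x y → G + x + y) at-t (sym at-r) ⟩
    G + (gt + b) + (gr + c)       ≡⟨ solve (G ∷ gt ∷ b ∷ gr ∷ c ∷ []) ⟩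
    G + (c + b) + (gr + gt)       ∎)
  where
  open ≡-Reasoning
  open ℕ-Solver using (solve)

mUpTo-≤ : ∀ d k → mUpTo d k ≤ k
mUpTo-≤ d zero    = z≤n
mUpTo-≤ d (suc k) with suc k ≤ᵇ suc (d (suc k))
... | true  = ≤-refl
... | false = m≤n⇒m≤1+n (mUpTo-≤ d k)

mUpTo-sound : ∀ d k → 1 ≤ mUpTo d k → mUpTo d k ≤ suc (d (mUpTo d k))
mUpTo-sound d (suc k) 1≤m with suc k ≤ᵇ suc (d (suc k)) in eq
... | true  = ≤ᵇ⇒≤ (suc k) (suc (d (suc k))) (subst T (sym eq) tt)
... | false = mUpTo-sound d k 1≤m

mUpTo-maximal : ∀ d k {j} → 1 ≤ j → j ≤ k → j ≤ suc (d j) → j ≤ mUpTo d k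
mUpTo-maximal d zero    (s≤s _) ()
mUpTo-maximal d (suc k) {j} 1≤j j≤1+k j≤1+dj with suc k ≤ᵇ suc (d (suc k)) in eq
... | true  = j≤1+k
... | false with j ≟ suc k
...   | yes refl = ⊥-elim (subst T eq (≤⇒≤ᵇ j≤1+dj))
...   | no  j≢1+k = mUpTo-maximal d k 1≤j (≤-pred (≤∧≢⇒< j≤1+k j≢1+k)) j≤1+dj

≤m⇒≤suc : ∀ {n d i k} → Nonincreasing n d → 1 ≤ i → i ≤ k → k ≤ m n d → k ≤ suc (d i)
≤m⇒≤suc {n} {d} {i} {k} nonincreasing 1≤i i≤k k≤m =
  ≤-trans k≤m (≤-trans (mUpTo-sound d n 1≤m) (s≤s d[m]≤d[i]))
  where
  1≤m = ≤-trans 1≤i (≤-trans i≤k k≤m)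
  d[m]≤d[i] = nonincreasing i (m n d) 1≤i (≤-trans i≤k k≤m) (mUpTo-≤ d n)

m≤1+n⇒m<n+2 : ∀ {m n} → m ≤ suc n → m < n + 2
m≤1+n⇒m<n+2 {n = n} m≤1+n = ≤-trans (s≤s m≤1+n) (≤-reflexive (+-comm 2 n))

jr≤ᵇ : ∀ d r k → (r ≤ k → k ≤ d r) → (jr d r ≤ᵇ k) ≡ (k <ᵇ r) ∧ (d r ≤ᵇ k)
jr≤ᵇ d r k k≤dr with r ≤? k | r ≤? d r
... | yes r≤k | yes r≤dr rewrite ≥⇒<ᵇ≡false r≤k | ≤⇒≤ᵇ≡true r≤dr = >⇒≤ᵇ≡false (s≤s (k≤dr r≤k))
... | yes r≤k | no  r≰dr = contradiction (≤-trans r≤k (k≤dr r≤k)) r≰dr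
... | no  r≰k | yes r≤dr rewrite <⇒<ᵇ≡true (≰⇒> r≰k) | ≤⇒≤ᵇ≡true r≤dr =
  trans (>⇒≤ᵇ≡false (m≤n⇒m≤1+n k<dr)) (sym (>⇒≤ᵇ≡false k<dr))
  where k<dr = <-≤-trans (≰⇒> r≰k) r≤dr
... | no  r≰k | no  r≰dr rewrite <⇒<ᵇ≡true (≰⇒> r≰k) | >⇒≤ᵇ≡false (≰⇒> r≰dr) = refl

jt≤ᵇ : ∀ d t k → (t ≤ k → k ≤ suc (d t)) → (jt d t ≤ᵇ k) ≡ (k <ᵇ t) ∧ (suc (d t) ≤ᵇ k)
jt≤ᵇ d t k k≤1+dt with t ≤? k | t ≤? suc (d t)
... | yes t≤k | yes t≤1+dt rewrite ≥⇒<ᵇ≡false t≤k | ≤⇒≤ᵇ≡true t≤1+dt =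
  >⇒≤ᵇ≡false (m≤1+n⇒m<n+2 (k≤1+dt t≤k))
... | yes t≤k | no  t≰1+dt = contradiction (≤-trans t≤k (k≤1+dt t≤k)) t≰1+dt
... | no  t≰k | yes t≤1+dt rewrite <⇒<ᵇ≡true (≰⇒> t≰k) | ≤⇒≤ᵇ≡true t≤1+dt =
  trans (>⇒≤ᵇ≡false (m≤1+n⇒m<n+2 (<⇒≤ k<1+dt))) (sym (>⇒≤ᵇ≡false k<1+dt))
  where k<1+dt = <-≤-trans (≰⇒> t≰k) t≤1+dt
... | no  t≰k | no  t≰1+dt rewrite <⇒<ᵇ≡true (≰⇒> t≰k) | >⇒≤ᵇ≡false (≰⇒> t≰1+dt) = refl

sub-rebalance : ∀ (a a′ x x′ y y′ p q : ℤ) →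
  a′ +ℤ (x′ +ℤ y) +ℤ q ≡ a +ℤ (x +ℤ y′) +ℤ p →
  (a′ +ℤ x′) -ℤ y′ ≡ ((a +ℤ x) -ℤ y +ℤ p) -ℤ q
sub-rebalance a a′ x x′ y y′ p q eq = begin
  (a′ +ℤ x′) -ℤ y′                           ≡⟨ solve (a′ ∷ x′ ∷ y ∷ y′ ∷ q ∷ []) ⟩
  (a′ +ℤ (x′ +ℤ y) +ℤ q) -ℤ y -ℤ q -ℤ y′     ≡⟨ cong (λ s → s -ℤ y -ℤ q -ℤ y′) eq ⟩
  (a +ℤ (x +ℤ y′) +ℤ p) -ℤ y -ℤ q -ℤ y′      ≡⟨ solve (a ∷ x ∷ y ∷ y′ ∷ p ∷ q ∷ []) ⟩
  ((a +ℤ x) -ℤ y +ℤ p) -ℤ q                  ∎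
  where
  open ≡-Reasoning
  open ℤ-Solver using (solve)

[1+k]*k≡k*[k∸1]+[k+k] : ∀ k → suc k * k ≡ k * (k ∸ 1) + (k + k)
[1+k]*k≡k*[k∸1]+[k+k] zero    = refl
[1+k]*k≡k*[k∸1]+[k+k] (suc k) = identity k
  where
  identity : ∀ k → suc (suc k) * suc k ≡ suc k * k + (suc k + suc k)
  identity = ℕ-Solver.solve-∀

-- Raising k to k+1 moves the value a (k+1) = k from the tail sum to the head sum, and
-- leaves every other term unchanged because the later values are at most k.
Δ-suc≡Δ : ∀ n (a : ℕ → ℕ) k → suc k ≤ n → a (suc k) ≡ k →
  (∀ i → suc k < i → i ≤ n → a i ≤ k) → Δ n a (suc k) ≡ Δ n a k
Δ-suc≡Δ n a k 1+k≤n a[1+k]≡k tail≤k =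
  trans (sub-rebalance (+ (k * (k ∸ 1))) (+ (suc k * k)) (+ A₀) (+ A₁) (+ C₀) (+ C₁) (+ 0) (+ 0)
                       (cong +_ balance))
        (trans (ℤ.+-identityʳ _) (ℤ.+-identityʳ _))
  where
  open ≡-Reasoning
  A₀ A₁ C₀ C₁ : ℕ
  A₀ = sumTo n (λ i → tailTerm k i (a i))
  A₁ = sumTo n (λ i → tailTerm (suc k) i (a i))
  C₀ = sumTo n (λ i → headTerm k i (a i))
  C₁ = sumTo n (λ i → headTerm (suc k) i (a i))

  f g : ℕ → ℕ
  f i = tailTerm (suc k) i (a i) + headTerm k i (a i)
  g i = tailTerm k i (a i) + headTerm (suc k) i (a i)

  f≗g : ∀ i → 1 ≤ i → i ≤ n → i ≢ suc k → f i ≡ g i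
  f≗g i _ i≤n i≢1+k with i ≤? k
  ... | yes i≤k rewrite ≥⇒<ᵇ≡false (m≤n⇒m≤1+n i≤k) | ≥⇒<ᵇ≡false i≤k
                      | ≤⇒≤ᵇ≡true i≤k | ≤⇒≤ᵇ≡true (m≤n⇒m≤1+n i≤k) = refl
  ... | no  i≰k with ≤∧≢⇒< (≰⇒> i≰k) (i≢1+k ∘ sym)
  ...   | 1+k<i rewrite <⇒<ᵇ≡true 1+k<i | <⇒<ᵇ≡true (≰⇒> i≰k)
                      | >⇒≤ᵇ≡false (≰⇒> i≰k) | >⇒≤ᵇ≡false 1+k<i
                      | m≥n⇒m⊓n≡n (tail≤k i 1+k<i i≤n)
                      | m≥n⇒m⊓n≡n (m≤n⇒m≤1+n (tail≤k i 1+k<i i≤n)) = refl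

  f-at : f (suc k) ≡ 0
  f-at rewrite ≥⇒<ᵇ≡false (≤-refl {suc k}) = refl

  g-at : g (suc k) ≡ k + k
  g-at rewrite <⇒<ᵇ≡true (n<1+n k) | a[1+k]≡k | ⊓-idem k = refl

  moved : A₁ + C₀ + (k + k) ≡ A₀ + C₁ + 0
  moved = begin
    A₁ + C₀ + (k + k)         ≡⟨ cong₂ _+_ (sym (sumTo-+ n _ _)) (sym g-at) ⟩
    sumTo n f + g (suc k)     ≡⟨ sumTo-one-point n (s≤s z≤n) 1+k≤n f≗g ⟩
    sumTo n g + f (suc k)     ≡⟨ cong₂ _+_ (sumTo-+ n _ _) f-at ⟩
    A₀ + C₁ + 0               ∎

  balance : suc k * k + (A₁ + C₀) + 0 ≡ k * (k ∸ 1) + (A₀ + C₁) + 0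
  balance = begin
    suc k * k + (A₁ + C₀) + 0                 ≡⟨ +-identityʳ _ ⟩
    suc k * k + (A₁ + C₀)                     ≡⟨ cong (_+ (A₁ + C₀)) ([1+k]*k≡k*[k∸1]+[k+k] k) ⟩
    k * (k ∸ 1) + (k + k) + (A₁ + C₀)         ≡⟨ +-assoc (k * (k ∸ 1)) (k + k) (A₁ + C₀) ⟩
    k * (k ∸ 1) + ((k + k) + (A₁ + C₀))       ≡⟨ cong (_+_ (k * (k ∸ 1))) (trans (+-comm (k + k) (A₁ + C₀)) moved) ⟩
    k * (k ∸ 1) + (A₀ + C₁ + 0)               ≡⟨ sym (+-assoc (k * (k ∸ 1)) (A₀ + C₁) 0) ⟩
    k * (k ∸ 1) + (A₀ + C₁) + 0               ∎

module UnitTransformation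
  {n : ℕ} {d : ℕ → ℕ} {r t : ℕ}
  (nonincreasing : Nonincreasing n d)
  (1≤r : 1 ≤ r) (r<t : r < t) (t≤n : t ≤ n)
  (dt+2≤dr : d t + 2 ≤ d r)
  (r-last : ∀ i → r < i → i < t → d i < d t + 2)
  where

  e : ℕ → ℕ
  e = unitTransform d r t

  1≤t : 1 ≤ t
  1≤t = ≤-trans 1≤r (<⇒≤ r<t)

  e-at-r : d r ≡ suc (e r)
  e-at-r rewrite ≡ᵇ-refl r = trans (sym (m∸n+n≡m 1≤dr)) (+-comm (d r ∸ 1) 1)
    where 1≤dr = ≤-trans (s≤s z≤n) (≤-trans (m≤n+m 2 (d t)) dt+2≤dr)

  e-at-t : e t ≡ suc (d t)
  e-at-t rewrite ≢⇒≡ᵇ≡false (<⇒≢ r<t ∘ sym) | ≡ᵇ-refl t = refl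

  e-elsewhere : ∀ {i} → i ≢ r → i ≢ t → e i ≡ d i
  e-elsewhere i≢r i≢t rewrite ≢⇒≡ᵇ≡false i≢r | ≢⇒≡ᵇ≡false i≢t = refl

  e≤d : ∀ {i} → i ≢ t → e i ≤ d i
  e≤d {i} i≢t with i ≟ r
  ... | yes refl = ≤-trans (n≤1+n (e i)) (≤-reflexive (sym e-at-r))
  ... | no  i≢r  = ≤-reflexive (e-elsewhere i≢r i≢t)

  -- This is where the choice of r as the last index with d r ≥ d t + 2 enters.
  e<dr : ∀ {j} → r ≤ j → j ≤ n → e j < d r
  e<dr {j} r≤j j≤n with j ≟ r | j ≟ t
  ... | yes refl | _        = ≤-reflexive (sym e-at-r)
  ... | no  _    | yes refl = ≤-trans (s≤s (≤-reflexive e-at-t)) (≤-trans (≤-reflexive (+-comm 2 (d t))) dt+2≤dr)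
  ... | no  j≢r  | no  j≢t rewrite e-elsewhere j≢r j≢t with j <? t
  ...   | yes j<t = ≤-trans (r-last j (≤∧≢⇒< r≤j (j≢r ∘ sym)) j<t) dt+2≤dr
  ...   | no  j≮t = ≤-trans (s≤s (nonincreasing t j 1≤t (≮⇒≥ j≮t) j≤n))
                            (≤-trans (n≤1+n (suc (d t))) (≤-trans (≤-reflexive (+-comm 2 (d t))) dt+2≤dr))

  r≤k⇒k≤dr : ∀ {k} → k ≤ m n e → r ≤ k → k ≤ d r
  r≤k⇒k≤dr {k} k≤me r≤k =
    ≤-trans k≤me (≤-trans (mUpTo-sound e n 1≤me) (e<dr (≤-trans r≤k k≤me) (mUpTo-≤ e n)))
    where 1≤me = ≤-trans 1≤r (≤-trans r≤k k≤me)

  t≤k⇒k≤1+dt : ∀ {k} → k ≤ m n d → t ≤ k → k ≤ suc (d t)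
  t≤k⇒k≤1+dt k≤md t≤k = ≤m⇒≤suc nonincreasing 1≤t t≤k k≤md

  Δ-below : ∀ k → k ≤ m n d → k ≤ m n e →
    Δ n e k ≡ (Δ n d k +ℤ + c₁ d r t k) -ℤ + c₋₁ d r t k
  Δ-below k k≤md k≤me =
    sub-rebalance (+ (k * (k ∸ 1))) (+ (k * (k ∸ 1))) (+ Ad) (+ Ae) (+ Cd) (+ Ce)
      (+ c₁ d r t k) (+ c₋₁ d r t k) (cong +_ balance)
    where
    Ad Ae Cd Ce : ℕ
    Ad = sumTo n (λ i → tailTerm k i (d i))
    Ae = sumTo n (λ i → tailTerm k i (e i))
    Cd = sumTo n (λ i → headTerm k i (d i))
    Ce = sumTo n (λ i → headTerm k i (e i))

    f g : ℕ → ℕ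
    f i = tailTerm k i (e i) + headTerm k i (d i)
    g i = tailTerm k i (d i) + headTerm k i (e i)

    f≗g : ∀ i → 1 ≤ i → i ≤ n → i ≢ r → i ≢ t → f i ≡ g i
    f≗g i _ _ i≢r i≢t rewrite e-elsewhere i≢r i≢t = refl

    at-r : g r + ind (r ≤ᵇ k) ≡ f r + ind (jr d r ≤ᵇ k)
    at-r rewrite jr≤ᵇ d r k (r≤k⇒k≤dr k≤me) = tailTerm-headTerm-suc k r e-at-r

    at-t : f t + ind (t ≤ᵇ k) ≡ g t + ind (jt d t ≤ᵇ k)
    at-t rewrite jt≤ᵇ d t k (t≤k⇒k≤1+dt k≤md) =
      subst (λ y → f t + ind (t ≤ᵇ k) ≡ g t + ind ((k <ᵇ t) ∧ (y ≤ᵇ k))) e-at-t (tailTerm-headTerm-suc k t e-at-t)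

    moved : Ae + Cd + c₋₁ d r t k ≡ Ad + Ce + c₁ d r t k
    moved = subst₂ (λ F G → F + c₋₁ d r t k ≡ G + c₁ d r t k)
      (sumTo-+ n (λ i → tailTerm k i (e i)) (λ i → headTerm k i (d i)))
      (sumTo-+ n (λ i → tailTerm k i (d i)) (λ i → headTerm k i (e i)))
      (+-cancel-two-points {sumTo n f} {sumTo n g} (sumTo-two-point n 1≤r r<t t≤n f≗g) at-t at-r)

    balance : k * (k ∸ 1) + (Ae + Cd) + c₋₁ d r t k ≡ k * (k ∸ 1) + (Ad + Ce) + c₁ d r t k
    balance = trans (+-assoc (k * (k ∸ 1)) _ _)
                (trans (cong (_+_ (k * (k ∸ 1))) moved) (sym (+-assoc (k * (k ∸ 1)) _ _)))

  module Jump (md<me : m n d < m n e) where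

    1≤me : 1 ≤ m n e
    1≤me = ≤-trans (s≤s z≤n) md<me

    me≰1+d : ¬ (m n e ≤ suc (d (m n e)))
    me≰1+d me≤1+d = <⇒≱ md<me (mUpTo-maximal d n 1≤me (mUpTo-≤ e n) me≤1+d)

    me≡t : m n e ≡ t
    me≡t with m n e ≟ t
    ... | yes me≡t = me≡t
    ... | no  me≢t = contradiction (≤-trans (mUpTo-sound e n 1≤me) (s≤s (e≤d me≢t))) me≰1+d

    t≡2+dt : t ≡ suc (suc (d t))
    t≡2+dt = ≤-antisym
      (≤-trans (subst (λ j → j ≤ suc (e j)) me≡t (mUpTo-sound e n 1≤me)) (s≤s (≤-reflexive e-at-t)))
      (≰⇒> (subst (λ j → ¬ (j ≤ suc (d j))) me≡t me≰1+d))

    1+dt<t : suc (d t) < t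
    1+dt<t = ≤-reflexive (sym t≡2+dt)

    md≡1+dt : m n d ≡ suc (d t)
    md≡1+dt = ≤-antisym
      (≤-pred (subst (m n d <_) (trans me≡t t≡2+dt) md<me))
      (mUpTo-maximal d n (s≤s z≤n) (≤-trans (<⇒≤ 1+dt<t) t≤n)
        (s≤s (nonincreasing (suc (d t)) t (s≤s z≤n) (<⇒≤ 1+dt<t) t≤n)))

    Δ-jump : Δ n e (m n e) ≡ Δ n d (m n d) +ℤ + 2
    Δ-jump = begin
      Δ n e (m n e)                                ≡⟨ cong (Δ n e) (trans me≡t t≡2+dt) ⟩
      Δ n e (suc k)                                ≡⟨ Δ-suc≡Δ n e k (subst (_≤ n) t≡2+dt t≤n) e[1+k]≡k tail≤k ⟩
      Δ n e k                                      ≡⟨ Δ-below k (≤-reflexive (sym md≡1+dt)) k≤me ⟩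
      (Δ n d k +ℤ + c₁ d r t k) -ℤ + c₋₁ d r t k   ≡⟨ cong₂ (λ p q → (Δ n d k +ℤ + p) -ℤ + q) c₁≡2 c₋₁≡0 ⟩
      (Δ n d k +ℤ + 2) -ℤ + 0                      ≡⟨ ℤ.+-identityʳ _ ⟩
      Δ n d k +ℤ + 2                               ≡⟨ cong (λ j → Δ n d j +ℤ + 2) (sym md≡1+dt) ⟩
      Δ n d (m n d) +ℤ + 2                         ∎
      where
      open ≡-Reasoning
      k : ℕ
      k = suc (d t)

      r≤k : r ≤ k
      r≤k = ≤-pred (subst (r <_) t≡2+dt r<t)

      k≤me : k ≤ m n e
      k≤me = subst (k ≤_) (sym me≡t) (<⇒≤ 1+dt<t)

      e[1+k]≡k : e (suc k) ≡ k
      e[1+k]≡k = subst (λ j → e j ≡ k) t≡2+dt e-at-t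

      tail≤k : ∀ i → suc k < i → i ≤ n → e i ≤ k
      tail≤k i 1+k<i i≤n =
        ≤-trans (≤-reflexive (e-elsewhere (<⇒≢ (<-trans r<t t<i) ∘ sym) (<⇒≢ t<i ∘ sym)))
                (m≤n⇒m≤1+n (nonincreasing t i 1≤t (<⇒≤ t<i) i≤n))
        where t<i = subst (_< i) (sym t≡2+dt) 1+k<i

      c₁≡2 : c₁ d r t k ≡ 2
      c₁≡2 rewrite ≤⇒≤ᵇ≡true r≤k | jt≤ᵇ d t k (λ _ → ≤-refl) | <⇒<ᵇ≡true 1+dt<t
                 | ≤⇒≤ᵇ≡true (≤-refl {k}) = refl

      c₋₁≡0 : c₋₁ d r t k ≡ 0
      c₋₁≡0 rewrite >⇒≤ᵇ≡false 1+dt<t | jr≤ᵇ d r k (r≤k⇒k≤dr k≤me) | ≥⇒<ᵇ≡false r≤k = refl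

  open Jump using (Δ-jump) public

lemma4p3 : (n : ℕ) (d : ℕ → ℕ) (r t : ℕ) →
    Nonincreasing n d → DegreeSequence n d →
    1 ≤ r → r < t → t ≤ n →
    d t + 2 ≤ d r →
    (∀ i → r < i → i < t → d r ∸ 2 < d i) →
    (∀ i → r < i → i < t → d i < d t + 2) →
    DegreeSequence n (unitTransform d r t) →
    ((k : ℕ) → k ≤ m n d → k ≤ m n (unitTransform d r t) →
       Δ n (unitTransform d r t) k ≡ (Δ n d k +ℤ + c₁ d r t k) -ℤ + c₋₁ d r t k)
    × (m n d < m n (unitTransform d r t) →
       Δ n (unitTransform d r t) (m n (unitTransform d r t)) ≡ Δ n d (m n d) +ℤ + 2)
lemma4p3 n d r t nonincreasing _ 1≤r r<t t≤n dt+2≤dr _ r-last _ = Δ-below , Δ-jump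
  where open UnitTransformation nonincreasing 1≤r r<t t≤n dt+2≤dr r-last
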